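{- Let $M_1,M_2$ be matroids and $\mathcal{I}=\mathcal{I}(M_1\vee M_2)$. Then for all $I,B\in\mathcal{I}$ with $B$ maximal in $\mathcal{I}$ and all $x\in I\setminus B$, there exists $y\in B\setminus I$ such that $(I+y)-x\in\mathcal{I}$.
   Context: Matroids may be infinite: a matroid on $E$ is a pair $(E,\mathcal{I})$ with $\mathcal{I}\subseteq\mathcal{P}(E)$ satisfying (I1) $\emptyset\in\mathcal{I}$; (I2) closure under subsets; (I3) whenever $I,I'\in\mathcal{I}$ with $I'$ maximal and $I$ not maximal, there is $x\in I'\setminus I$ with $I+x\in\mathcal{I}$; (IM) whenever $I\subseteq X\subseteq E$ and $I\in\mathcal{I}$, the set $\{I'\in\mathcal{I}: I\subseteq I'\subseteq X\}$ has a maximal element. For matroids $M_1,M_2$ on ground sets $E_1,E_2$, $\mathcal{I}(M_1\vee M_2)=\{I_1\cup I_2: I_1\in\mathcal{I}(M_1), I_2\in\mathcal{I}(M_2)\}$, a set system on $E_1\cup E_2$. Here $I+y=I\cup\{y\}$ and $I-x=I\setminus\{x\}$. -}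

module Defs where

open import Level using (0ℓ)
import Level
open import Data.Product using (Σ; _×_; ∃; ∃-syntax; _,_)
open import Data.Sum using (_⊎_)
open import Relation.Nullary using (¬_)
open import Data.Empty using (⊥)
open import Relation.Binary.PropositionalEquality using (_≡_; _≢_)
open import Relation.Unary using (Pred; _∈_; _∉_; _⊆_; _∪_)

Subset : Set → Set₁
Subset A = Pred A 0ℓ

SetSystem : Set → Set₂
SetSystem A = Pred (Subset A) (Level.suc 0ℓ)

_+ₛ_ : {A : Set} → Subset A → A → Subset A
(I +ₛ y) z = z ∈ I ⊎ z ≡ y

_-ₛ_ : {A : Set} → Subset A → A → Subset A
(I -ₛ x) z = z ∈ I × z ≢ x

Maximal : {A : Set} → SetSystem A → Subset A → Set₁
Maximal {A} 𝓘 I = I ∈ 𝓘 × (∀ (J : Subset A) → J ∈ 𝓘 → I ⊆ J → J ⊆ I)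

record Matroid (A : Set) : Set₂ where
  field
    E   : Subset A
    𝓘   : SetSystem A
    indep⊆E : ∀ (I : Subset A) → I ∈ 𝓘 → I ⊆ E
    I1  : (λ _ → ⊥) ∈ 𝓘
    I2  : ∀ (I J : Subset A) → I ∈ 𝓘 → J ⊆ I → J ∈ 𝓘
    I3  : ∀ (I I' : Subset A) → I ∈ 𝓘 → Maximal 𝓘 I' → ¬ Maximal 𝓘 I →
          ∃[ x ] (x ∈ I' × x ∉ I × (I +ₛ x) ∈ 𝓘)
    IM  : ∀ (I X : Subset A) → I ∈ 𝓘 → I ⊆ X → X ⊆ E →
          Σ (Subset A) λ J → (J ∈ 𝓘 × I ⊆ J × J ⊆ X) ×
            (∀ (J' : Subset A) → J' ∈ 𝓘 → I ⊆ J' → J' ⊆ X → J ⊆ J' → J' ⊆ J)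

unionIndep : {A : Set} → Matroid A → Matroid A → SetSystem A
unionIndep {A} M₁ M₂ J =
  Σ (Subset A) λ I₁ → Σ (Subset A) λ I₂ →
    I₁ ∈ Matroid.𝓘 M₁ × I₂ ∈ Matroid.𝓘 M₂ × J ⊆ (I₁ ∪ I₂) × (I₁ ∪ I₂) ⊆ J

-- Write I = I₁ ∪ I₂ with x ∈ I₁ (by symmetry) and put Jᵢ = Iᵢ − x.  In the exchange graph of
-- (J₁, J₂) an edge a → b says that a can replace b in J₁ (in M₁) or in J₂ (in M₂), and a sink is an
-- element that can be added to J₁ or J₂ outright.  Performing the exchanges along a shortest path
-- from y to a sink shows that (J₁ ∪ J₂) + y is independent in M₁ ∨ M₂ (the augmenting-path argument
-- of matroid union, by induction on the length of the path).  It remains to find such a y in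
-- B ∖ (J₁ ∪ J₂).  The unreachable elements of Mᵢ are spanned by the unreachable part of Iᵢ, so if
-- every reachable element of B lay in J₁ ∪ J₂, replacing the reachable part of each Bᵢ by the
-- reachable part of Iᵢ would give a set independent in M₁ ∨ M₂ containing B and the sink x.
-- For infinite matroids the exchange and closure facts are derived from (I3) inside restrictions
-- M|X, whose maximal independent sets (IM) provides.

module Submission where

open import Defs
open import Level using (0ℓ)
import Level
open import Data.Product using (Σ; _×_; ∃; ∃-syntax; _,_; proj₁; proj₂)
open import Relation.Unary using (Pred; _∈_; _∉_; _⊆_; _∪_; _∩_; _∖_)
open import Axiom.ExcludedMiddle using (ExcludedMiddle)
open import Axiom.DoubleNegationElimination using (DoubleNegationElimination; em⇒dne)
open import Data.Empty using (⊥; ⊥-elim)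
open import Data.Sum using (_⊎_; inj₁; inj₂; [_,_])
import Data.Sum
open import Data.Nat using (ℕ; suc; _<_; _≤_; s≤s)
open import Data.Nat.Properties using (≤-refl; <⇒≤)
open import Data.Nat.Induction using (<-rec)
open import Function using (case_of_)
open import Relation.Nullary using (¬_; yes; no)
open import Relation.Nullary.Decidable using (True; toWitness; fromWitness)
open import Relation.Binary.PropositionalEquality using (_≡_; _≢_; refl)

+ₛ-mono : {A : Set} {K L : Subset A} {z : A} → K ⊆ L → K +ₛ z ⊆ L +ₛ z
+ₛ-mono K⊆L (inj₁ p) = inj₁ (K⊆L p)
+ₛ-mono K⊆L (inj₂ e) = inj₂ e

-ₛ-mono : {A : Set} {K L : Subset A} {z : A} → K ⊆ L → K -ₛ z ⊆ L -ₛ z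
-ₛ-mono K⊆L (p , ne) = K⊆L p , ne

module WithExcludedMiddle (em₀ : ExcludedMiddle 0ℓ) (em₁ : ExcludedMiddle (Level.suc 0ℓ))
                          {A : Set} where

  dne₀ : DoubleNegationElimination 0ℓ
  dne₀ = em⇒dne em₀

  dne₁ : DoubleNegationElimination (Level.suc 0ℓ)
  dne₁ = em⇒dne em₁

  module MatroidFacts (M : Matroid A) where
    open Matroid M

    Independent : Subset A → Set₁
    Independent J = J ∈ 𝓘

    indep-⊆ : ∀ {I J} → Independent I → J ⊆ I → Independent J
    indep-⊆ {I} {J} = I2 I J

    record MaximalIn (X : Subset A) : Set₁ where
      field
        set     : Subset A
        indep   : Independent set
        ⊆X      : set ⊆ X
        maximal : ∀ J → Independent J → set ⊆ J → J ⊆ X → J ⊆ set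

    maximalExtension : ∀ {I X} → Independent I → I ⊆ X → X ⊆ E →
                       Σ (MaximalIn X) λ T → I ⊆ MaximalIn.set T
    maximalExtension {I} {X} iI I⊆X X⊆E with IM I X iI I⊆X X⊆E
    ... | T , (iT , I⊆T , T⊆X) , max =
      record { set = T ; indep = iT ; ⊆X = T⊆X
             ; maximal = λ J iJ T⊆J J⊆X → max J iJ (λ p → T⊆J (I⊆T p)) J⊆X T⊆J }
       , I⊆T

    extendToBase : ∀ {I} → Independent I → Σ (Subset A) λ B → Maximal 𝓘 B × I ⊆ B
    extendToBase iI with maximalExtension iI (indep⊆E _ iI) (λ p → p)
    ... | T , I⊆T = T.set , (T.indep , λ J iJ T⊆J → T.maximal J iJ T⊆J (indep⊆E J iJ)) , I⊆T
      where module T = MaximalIn T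

    maximalIn-⊇base : ∀ {X B} (T : MaximalIn X) → Maximal 𝓘 B → B ⊆ X →
                      Maximal 𝓘 (MaximalIn.set T)
    maximalIn-⊇base {B = B} T baseB B⊆X =
      dne₁ λ ¬max → let b , b∈B , b∉T , iTb = I3 T.set B T.indep baseB ¬max in
        b∉T (T.maximal (T.set +ₛ b) iTb inj₁ [ T.⊆X , (λ { refl → B⊆X b∈B }) ] (inj₂ refl))
      where module T = MaximalIn T

    maximalIn-∪-outside : ∀ {X Z} (T : MaximalIn X) → Maximal 𝓘 Z →
                          Independent (MaximalIn.set T ∪ (Z ∖ X)) →
                          Maximal 𝓘 (MaximalIn.set T ∪ (Z ∖ X))
    maximalIn-∪-outside {X} {Z} T baseZ iW =
      dne₁ λ ¬max → let e , e∈Z , e∉W , iWe = I3 W Z iW baseZ ¬max in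
        case em₀ {e ∈ X} of λ where
          (no e∉X) → e∉W (inj₂ (e∈Z , e∉X))
          (yes e∈X) → e∉W (inj₁ (T.maximal (T.set +ₛ e)
                                           (indep-⊆ iWe (+ₛ-mono {K = T.set} {L = W} inj₁)) inj₁
                                           [ T.⊆X , (λ { refl → e∈X }) ] (inj₂ refl)))
      where
        module T = MaximalIn T
        W : Subset A
        W = T.set ∪ (Z ∖ X)

    -- (I3) for the restriction M|X: with Z a base through I + u, compare I ∪ (Z ∖ X) with the
    -- base T ∪ (Z ∖ X).
    augment-within : ∀ {X I u} (T : MaximalIn X) → I ⊆ X → u ∈ X → u ∉ I →
                     Independent (I +ₛ u) →
                     ∃[ t ] (t ∈ MaximalIn.set T × t ∉ I × Independent (I +ₛ t))
    augment-within {X} {I} {u} T I⊆X u∈X u∉I iIu =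
      conclude (I3 V W (indep-⊆ Z.indep V⊆Z) (maximalIn-∪-outside T baseZ iW) ¬maxV)
      where
        module T = MaximalIn T

        B : Subset A
        B = proj₁ (extendToBase T.indep)

        baseB : Maximal 𝓘 B
        baseB = proj₁ (proj₂ (extendToBase T.indep))

        T⊆B : T.set ⊆ B
        T⊆B = proj₂ (proj₂ (extendToBase T.indep))

        U : Subset A
        U = (I +ₛ u) ∪ B

        U⊆E : U ⊆ E
        U⊆E = [ indep⊆E _ iIu , indep⊆E B (proj₁ baseB) ]

        extensionZ : Σ (MaximalIn U) λ Z → I +ₛ u ⊆ MaximalIn.set Z
        extensionZ = maximalExtension iIu inj₁ U⊆E

        module Z = MaximalIn (proj₁ extensionZ)

        baseZ : Maximal 𝓘 Z.set
        baseZ = maximalIn-⊇base (proj₁ extensionZ) baseB inj₂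

        W : Subset A
        W = T.set ∪ (Z.set ∖ X)

        iW : Independent W
        iW = indep-⊆ (proj₁ baseB) [ T⊆B , (λ (z∈Z , z∉X) → outside (Z.⊆X z∈Z) z∉X) ]
          where
            outside : ∀ {z} → z ∈ U → z ∉ X → z ∈ B
            outside (inj₁ (inj₁ z∈I)) z∉X = ⊥-elim (z∉X (I⊆X z∈I))
            outside (inj₁ (inj₂ refl)) z∉X = ⊥-elim (z∉X u∈X)
            outside (inj₂ z∈B) _ = z∈B

        V : Subset A
        V = I ∪ (Z.set ∖ X)

        V⊆Z : V ⊆ Z.set
        V⊆Z = [ (λ z∈I → proj₂ extensionZ (inj₁ z∈I)) , proj₁ ]

        ¬maxV : ¬ Maximal 𝓘 V
        ¬maxV (_ , maxV)
          with maxV (V +ₛ u) (indep-⊆ Z.indep [ V⊆Z , (λ { refl → proj₂ extensionZ (inj₂ refl) }) ])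
                    inj₁ (inj₂ refl)
        ... | inj₁ u∈I = u∉I u∈I
        ... | inj₂ (_ , u∉X) = u∉X u∈X

        conclude : ∃[ e ] (e ∈ W × e ∉ V × Independent (V +ₛ e)) →
                   ∃[ t ] (t ∈ T.set × t ∉ I × Independent (I +ₛ t))
        conclude (e , inj₁ e∈T , e∉V , iVe) =
          e , e∈T , (λ e∈I → e∉V (inj₁ e∈I)) , indep-⊆ iVe (+ₛ-mono {L = V} inj₁)
        conclude (e , inj₂ e∈Z∖X , e∉V , _) = ⊥-elim (e∉V (inj₂ e∈Z∖X))

    cl : Subset A → Pred A (Level.suc 0ℓ)
    cl K z = z ∈ K ⊎ ¬ Independent (K +ₛ z)

    cl-mono : ∀ {K L} → K ⊆ L → cl K ⊆ cl L
    cl-mono K⊆L (inj₁ z∈K) = inj₁ (K⊆L z∈K)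
    cl-mono {K} K⊆L {z} (inj₂ dep) =
      inj₂ λ iLz → dep (indep-⊆ iLz (+ₛ-mono {K = K} {z = z} K⊆L))

    cl-trans : ∀ {J K} → Independent J → J ⊆ cl K → cl J ⊆ cl K
    cl-trans iJ J⊆clK (inj₁ z∈J) = J⊆clK z∈J
    cl-trans {J} {K} iJ J⊆clK {z} (inj₂ depJz) with em₀ {z ∈ K} | em₁ {Independent (K +ₛ z)}
    ... | yes z∈K | _ = inj₁ z∈K
    ... | no _ | no depKz = inj₂ depKz
    ... | no z∉K | yes iKz = ⊥-elim (contradiction (augment-within R K⊆X (inj₂ refl) z∉K iKz))
      where
        X : Subset A
        X = (K ∪ J) +ₛ z

        K⊆X : K ⊆ X
        K⊆X k = inj₁ (inj₁ k)

        X⊆E : X ⊆ E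
        X⊆E = [ [ indep⊆E _ (indep-⊆ iKz inj₁) , indep⊆E J iJ ]
              , (λ { refl → indep⊆E _ iKz (inj₂ refl) }) ]

        extensionR : Σ (MaximalIn X) λ R → J ⊆ MaximalIn.set R
        extensionR = maximalExtension iJ (λ j → inj₁ (inj₂ j)) X⊆E

        R : MaximalIn X
        R = proj₁ extensionR
        module R = MaximalIn R

        z∉R : z ∉ R.set
        z∉R z∈R = depJz (indep-⊆ R.indep [ proj₂ extensionR , (λ { refl → z∈R }) ])

        contradiction : ∃[ t ] (t ∈ R.set × t ∉ K × Independent (K +ₛ t)) → ⊥
        contradiction (t , t∈R , t∉K , iKt) with R.⊆X t∈R
        ... | inj₁ (inj₁ t∈K) = t∉K t∈K
        ... | inj₂ refl = z∉R t∈R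
        ... | inj₁ (inj₂ t∈J) with J⊆clK t∈J
        ...   | inj₁ t∈K = t∉K t∈K
        ...   | inj₂ depKt = depKt iKt

    exchange-avoiding : ∀ {J S z} → Independent J → S ⊆ J → Independent (S +ₛ z) →
                        ¬ Independent (J +ₛ z) →
                        ∃[ w ] (w ∈ J × w ∉ S × Independent ((J -ₛ w) +ₛ z))
    exchange-avoiding {J} {S} {z} iJ S⊆J iSz depJz =
      case em₀ {∃[ w ] (w ∈ J × w ∉ T.set)} of λ where
        (no J⊈T) → ⊥-elim (depJz (indep-⊆ T.indep
                     [ (λ w∈J → dne₀ λ w∉T → J⊈T (_ , w∈J , w∉T))
                     , (λ { refl → Sz⊆T (inj₂ refl) }) ]))
        (yes (w , w∈J , w∉T)) → exchange w∈J w∉T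
      where
        X⊆E : J +ₛ z ⊆ E
        X⊆E = [ indep⊆E J iJ , (λ { refl → indep⊆E _ iSz (inj₂ refl) }) ]

        extensionT : Σ (MaximalIn (J +ₛ z)) λ T → S +ₛ z ⊆ MaximalIn.set T
        extensionT = maximalExtension iSz (+ₛ-mono {K = S} S⊆J) X⊆E

        T : MaximalIn (J +ₛ z)
        T = proj₁ extensionT
        module T = MaximalIn T

        Sz⊆T : S +ₛ z ⊆ T.set
        Sz⊆T = proj₂ extensionT

        exchange : ∀ {w} → w ∈ J → w ∉ T.set →
                   ∃[ w ] (w ∈ J × w ∉ S × Independent ((J -ₛ w) +ₛ z))
        exchange {w} w∈J w∉T
          with augment-within T (λ p → inj₁ (proj₁ p)) (inj₁ w∈J) (λ p → proj₂ p refl)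
                              (indep-⊆ iJ [ proj₁ , (λ { refl → w∈J }) ])
        ... | t , t∈T , t∉J-w , iJ-w+t with T.⊆X t∈T
        ...   | inj₂ refl = w , w∈J , (λ w∈S → w∉T (Sz⊆T (inj₁ w∈S))) , iJ-w+t
        ...   | inj₁ t∈J = ⊥-elim (t∉J-w (t∈J , λ { refl → w∉T t∈T }))

    ∉cl-minus : ∀ {Q l} → Independent Q → l ∈ Q → l ∉ cl (Q -ₛ l)
    ∉cl-minus iQ l∈Q (inj₁ (_ , l≢l)) = l≢l refl
    ∉cl-minus iQ l∈Q (inj₂ dep) = dep (indep-⊆ iQ [ proj₁ , (λ { refl → l∈Q }) ])

    spanned-∪-indep : ∀ {P Q D} → Independent P → Independent Q → P ⊆ cl (Q ∖ D) →
                      Independent (P ∪ (Q ∩ D))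
    spanned-∪-indep {P} {Q} {D} iP iQ P⊆cl = dne₁ λ depPQ →
      case em₀ {∃[ l ] (l ∈ Q ∩ D × l ∉ U.set)} of λ where
        (no Q∩D⊈U) → depPQ (indep-⊆ U.indep
                       [ P⊆U , (λ l∈Q∩D → dne₀ λ l∉U → Q∩D⊈U (_ , l∈Q∩D , l∉U)) ])
        (yes (l , l∈Q∩D , l∉U)) → ∉cl-minus iQ (proj₁ l∈Q∩D) (l∈cl l∈Q∩D l∉U)
      where
        X⊆E : P ∪ (Q ∩ D) ⊆ E
        X⊆E = [ indep⊆E P iP , (λ p → indep⊆E Q iQ (proj₁ p)) ]

        extensionU : Σ (MaximalIn (P ∪ (Q ∩ D))) λ U → P ⊆ MaximalIn.set U
        extensionU = maximalExtension iP inj₁ X⊆E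

        module U = MaximalIn (proj₁ extensionU)

        P⊆U : P ⊆ U.set
        P⊆U = proj₂ extensionU

        l∈cl : ∀ {l} → l ∈ Q ∩ D → l ∉ U.set → l ∈ cl (Q -ₛ l)
        l∈cl {l} (l∈Q , l∈D) l∉U = cl-trans U.indep U⊆cl (inj₂ depUl)
          where
            depUl : ¬ Independent (U.set +ₛ l)
            depUl iUl =
              l∉U (U.maximal _ iUl inj₁ [ U.⊆X , (λ { refl → inj₂ (l∈Q , l∈D) }) ] (inj₂ refl))

            U⊆cl : U.set ⊆ cl (Q -ₛ l)
            U⊆cl u∈U with U.⊆X u∈U
            ... | inj₁ u∈P = cl-mono (λ (y∈Q , y∉D) → y∈Q , λ { refl → y∉D l∈D }) (P⊆cl u∈P)
            ... | inj₂ (u∈Q , _) = inj₁ (u∈Q , λ { refl → l∉U u∈U })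

    Addable : Subset A → A → Set₁
    Addable J a = a ∉ J × Independent (J +ₛ a)

    Exchange : Subset A → A → A → Set₁
    Exchange J a b = a ∉ J × b ∈ J × ¬ Independent (J +ₛ a) × Independent ((J -ₛ b) +ₛ a)

    addable-of-⊆cl : ∀ {J K n} → Independent K → K ⊆ cl J → Addable J n →
                     Independent (K +ₛ n)
    addable-of-⊆cl iK K⊆clJ (n∉J , iJn) =
      dne₁ λ depKn → [ n∉J , (λ depJn → depJn iJn) ] (cl-trans iK K⊆clJ (inj₂ depKn))

    exchange-closed⇒∁⊆cl : ∀ {J R} → Independent J →
                           (∀ {z} → Addable J z → z ∈ R) →
                           (∀ {z w} → Exchange J z w → w ∈ R → z ∈ R) →
                           ∀ {z} → z ∉ R → z ∈ cl (J ∖ R)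
    exchange-closed⇒∁⊆cl {J} {R} iJ addable exchange {z} z∉R
      with em₀ {z ∈ J} | em₁ {Independent (J +ₛ z)} | em₁ {Independent ((J ∖ R) +ₛ z)}
    ... | yes z∈J | _ | _ = inj₁ (z∈J , z∉R)
    ... | no z∉J | yes iJz | _ = ⊥-elim (z∉R (addable (z∉J , iJz)))
    ... | no _ | no _ | no depJ∖Rz = inj₂ depJ∖Rz
    ... | no z∉J | no depJz | yes iJ∖Rz with exchange-avoiding iJ proj₁ iJ∖Rz depJz
    ...   | w , w∈J , w∉J∖R , iJ-w+z =
      ⊥-elim (z∉R (exchange (z∉J , w∈J , depJz , iJ-w+z) (dne₀ λ w∉R → w∉J∖R (w∈J , w∉R))))

  open MatroidFacts using (Independent; indep-⊆; Addable; Exchange)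

  unionIndep-⊆ : ∀ {M₁ M₂ : Matroid A} {P Q} → P ∈ unionIndep M₁ M₂ → Q ⊆ P →
                 Q ∈ unionIndep M₁ M₂
  unionIndep-⊆ {M₁} {M₂} {Q = Q} (P₁ , P₂ , iP₁ , iP₂ , P⊆P₁∪P₂ , _) Q⊆P =
    Q ∩ P₁ , Q ∩ P₂ , indep-⊆ M₁ iP₁ proj₂ , indep-⊆ M₂ iP₂ proj₂ ,
    (λ q → Data.Sum.map (q ,_) (q ,_) (P⊆P₁∪P₂ (Q⊆P q))) , [ proj₁ , proj₁ ]

  unionIndep-comm : ∀ {M₁ M₂ : Matroid A} {P} → P ∈ unionIndep M₁ M₂ → P ∈ unionIndep M₂ M₁
  unionIndep-comm (P₁ , P₂ , iP₁ , iP₂ , P⊆P₁∪P₂ , P₁∪P₂⊆P) =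
    P₂ , P₁ , iP₂ , iP₁ , (λ p → Data.Sum.swap (P⊆P₁∪P₂ p)) , (λ p → P₁∪P₂⊆P (Data.Sum.swap p))

  unionMaximal-comm : ∀ {M₁ M₂ : Matroid A} {B} → Maximal (unionIndep M₁ M₂) B →
                      Maximal (unionIndep M₂ M₁) B
  unionMaximal-comm {M₁} {M₂} (iB , maximal) =
    unionIndep-comm {M₁} {M₂} iB , λ J iJ B⊆J → maximal J (unionIndep-comm {M₂} {M₁} iJ) B⊆J

  module ExchangeGraph (M₁ M₂ : Matroid A) (J₁ J₂ : Subset A) where

    Edge : A → A → Set₁
    Edge a b = Exchange M₁ J₁ a b ⊎ Exchange M₂ J₂ a b

    Sink : A → Set₁
    Sink a = Addable M₁ J₁ a ⊎ Addable M₂ J₂ a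

    data Path (y : A) : A → ℕ → Set₁ where
      []   : Path y y 0
      _∷ʳ_ : ∀ {v w m} → Path y v m → Edge v w → Path y w (suc m)

    SinkPath : A → ℕ → Set₁
    SinkPath y m = ∃[ v ] (Path y v m × Sink v)

  open ExchangeGraph using (Edge; Sink; Path; []; _∷ʳ_; SinkPath)

  _◅_ : ∀ {M₁ M₂ J₁ J₂ z w v m} → Edge M₁ M₂ J₁ J₂ z w → Path M₁ M₂ J₁ J₂ w v m →
        Path M₁ M₂ J₁ J₂ z v (suc m)
  e ◅ [] = [] ∷ʳ e
  e ◅ (p ∷ʳ e′) = (e ◅ p) ∷ʳ e′

  swap-path : ∀ {M₁ M₂ J₁ J₂ y v m} → Path M₁ M₂ J₁ J₂ y v m → Path M₂ M₁ J₂ J₁ y v m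
  swap-path [] = []
  swap-path (p ∷ʳ e) = swap-path p ∷ʳ Data.Sum.swap e

  swap-sinkPath : ∀ {M₁ M₂ J₁ J₂ y m} → SinkPath M₁ M₂ J₁ J₂ y m → SinkPath M₂ M₁ J₂ J₁ y m
  swap-sinkPath (v , p , s) = v , swap-path p , Data.Sum.swap s

  unionIndep-+ₛ : ∀ {M₁ M₂ : Matroid A} {J₁ J₂ y} → Independent M₁ (J₁ +ₛ y) →
                  Independent M₂ J₂ → (J₁ ∪ J₂) +ₛ y ∈ unionIndep M₁ M₂
  unionIndep-+ₛ {J₁ = J₁} {J₂} {y} iJ₁y iJ₂ = J₁ +ₛ y , J₂ , iJ₁y , iJ₂ , ⊆∪ , ∪⊆
    where
      ⊆∪ : (J₁ ∪ J₂) +ₛ y ⊆ (J₁ +ₛ y) ∪ J₂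
      ⊆∪ (inj₁ (inj₁ z∈J₁)) = inj₁ (inj₁ z∈J₁)
      ⊆∪ (inj₁ (inj₂ z∈J₂)) = inj₂ z∈J₂
      ⊆∪ (inj₂ refl) = inj₁ (inj₂ refl)

      ∪⊆ : (J₁ +ₛ y) ∪ J₂ ⊆ (J₁ ∪ J₂) +ₛ y
      ∪⊆ (inj₁ (inj₁ z∈J₁)) = inj₁ (inj₁ z∈J₁)
      ∪⊆ (inj₁ (inj₂ refl)) = inj₂ refl
      ∪⊆ (inj₂ z∈J₂) = inj₁ (inj₂ z∈J₂)

  unionIndep-+ₛ-comm : ∀ {M₁ M₂ : Matroid A} {J₁ J₂ y} → (J₂ ∪ J₁) +ₛ y ∈ unionIndep M₂ M₁ →
                       (J₁ ∪ J₂) +ₛ y ∈ unionIndep M₁ M₂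
  unionIndep-+ₛ-comm {M₁} {M₂} {J₁} {J₂} indep =
    unionIndep-⊆ {M₁} {M₂} (unionIndep-comm {M₂} {M₁} indep)
                 (+ₛ-mono {K = J₁ ∪ J₂} Data.Sum.swap)

  Augments : ℕ → Set₂
  Augments m = ∀ {M₁ M₂ : Matroid A} {J₁ J₂ y} → Independent M₁ J₁ → Independent M₂ J₂ →
               SinkPath M₁ M₂ J₁ J₂ y m → (J₁ ∪ J₂) +ₛ y ∈ unionIndep M₁ M₂

  -- Moving the sink w of a shortest sink path from J₂ to J₁ makes its predecessor v a sink; the
  -- shorter path y ⋯ v stays a path, since any broken edge would give a still shorter sink path.
  reroute : ∀ {M₁ M₂ : Matroid A} {J₁ J₂ y v w m} → Augments m → Independent M₂ J₂ →
            Path M₁ M₂ J₁ J₂ y v m → Exchange M₂ J₂ v w → Addable M₁ J₁ w →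
            (∀ {j} → j < suc m → ¬ SinkPath M₁ M₂ J₁ J₂ y j) →
            (J₁ ∪ J₂) +ₛ y ∈ unionIndep M₁ M₂
  reroute {M₁} {M₂} {J₁} {J₂} {y} {v} {w} {m} augments iJ₂ p (v∉J₂ , w∈J₂ , _ , iJ₂-w+v)
          w-addable shortest =
    unionIndep-⊆ {M₁} {M₂}
      (augments (proj₂ w-addable) (indep-⊆ M₂ iJ₂ proj₁)
                (v , transfer p ≤-refl , inj₂ ((λ v∈J₂′ → v∉J₂ (proj₁ v∈J₂′)) , iJ₂-w+v)))
      ⊆moved
    where
      J₁′ J₂′ : Subset A
      J₁′ = J₁ +ₛ w
      J₂′ = J₂ -ₛ w

      ⊆moved : (J₁ ∪ J₂) +ₛ y ⊆ (J₁′ ∪ J₂′) +ₛ y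
      ⊆moved (inj₁ (inj₁ z∈J₁)) = inj₁ (inj₁ (inj₁ z∈J₁))
      ⊆moved {z} (inj₁ (inj₂ z∈J₂)) with em₀ {z ≡ w}
      ... | yes z≡w = inj₁ (inj₁ (inj₂ z≡w))
      ... | no z≢w = inj₁ (inj₂ (z∈J₂ , z≢w))
      ⊆moved (inj₂ z≡y) = inj₂ z≡y

      transfer-edge : ∀ {a b j} → Path M₁ M₂ J₁ J₂ y a j → Edge M₁ M₂ J₁ J₂ a b → j < m →
                      Edge M₁ M₂ J₁′ J₂′ a b
      transfer-edge {a} {b} {j} q e j<m with e
      ... | inj₁ (a∉J₁ , b∈J₁ , depJ₁a , iJ₁-b+a) =
        inj₁ ([ a∉J₁ , a≢w ] , inj₁ b∈J₁ ,
              (λ i → depJ₁a (indep-⊆ M₁ i (+ₛ-mono {L = J₁′} inj₁))) ,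
              indep-⊆ M₁ (MatroidFacts.addable-of-⊆cl M₁ iJ₁-b+a
                            [ (λ z → inj₁ (proj₁ z)) , (λ { refl → inj₂ depJ₁a }) ] w-addable)
                         reorder)
        where
          a≢w : a ≢ w
          a≢w refl = shortest (s≤s (<⇒≤ j<m)) (w , q , inj₁ w-addable)

          reorder : (J₁′ -ₛ b) +ₛ a ⊆ ((J₁ -ₛ b) +ₛ a) +ₛ w
          reorder (inj₁ (inj₁ z∈J₁ , z≢b)) = inj₁ (inj₁ (z∈J₁ , z≢b))
          reorder (inj₁ (inj₂ z≡w , _)) = inj₂ z≡w
          reorder (inj₂ z≡a) = inj₁ (inj₂ z≡a)
      ... | inj₂ (a∉J₂ , b∈J₂ , depJ₂a , iJ₂-b+a) =
        inj₂ ((λ a∈J₂′ → a∉J₂ (proj₁ a∈J₂′)) , (b∈J₂ , b≢w) ,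
              (λ i → shortest (s≤s j<m)
                                (w , q ∷ʳ inj₂ (a∉J₂ , w∈J₂ , depJ₂a , i) , inj₁ w-addable)) ,
              indep-⊆ M₂ iJ₂-b+a
                (+ₛ-mono {K = J₂′ -ₛ b} {L = J₂ -ₛ b} (-ₛ-mono {K = J₂′} {L = J₂} proj₁)))
        where
          b≢w : b ≢ w
          b≢w refl = shortest (s≤s j<m) (w , q ∷ʳ e , inj₁ w-addable)

      transfer : ∀ {a j} → Path M₁ M₂ J₁ J₂ y a j → j ≤ m → Path M₁ M₂ J₁′ J₂′ y a j
      transfer [] _ = []
      transfer (q ∷ʳ e) j<m = transfer q (<⇒≤ j<m) ∷ʳ transfer-edge q e j<m

  augment-shortest : ∀ {m} → (∀ {j} → j < m → Augments j) →
                     ∀ {M₁ M₂ : Matroid A} {J₁ J₂ y} → Independent M₁ J₁ → Independent M₂ J₂ →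
                     SinkPath M₁ M₂ J₁ J₂ y m → (∀ {j} → j < m → ¬ SinkPath M₁ M₂ J₁ J₂ y j) →
                     (J₁ ∪ J₂) +ₛ y ∈ unionIndep M₁ M₂
  augment-shortest _ {M₁} {M₂} _ iJ₂ (_ , [] , inj₁ (_ , iJ₁y)) _ =
    unionIndep-+ₛ {M₁} {M₂} iJ₁y iJ₂
  augment-shortest _ {M₁} {M₂} iJ₁ _ (_ , [] , inj₂ (_ , iJ₂y)) _ =
    unionIndep-+ₛ-comm {M₁} {M₂} (unionIndep-+ₛ {M₂} {M₁} iJ₂y iJ₁)
  augment-shortest _ _ _ (_ , _ ∷ʳ inj₁ (_ , w∈J₁ , _) , inj₁ (w∉J₁ , _)) _ =
    ⊥-elim (w∉J₁ w∈J₁)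
  augment-shortest _ _ _ (_ , _ ∷ʳ inj₂ (_ , w∈J₂ , _) , inj₂ (w∉J₂ , _)) _ =
    ⊥-elim (w∉J₂ w∈J₂)
  augment-shortest IH _ iJ₂ (_ , p ∷ʳ inj₂ e , inj₁ w-addable) shortest =
    reroute (IH ≤-refl) iJ₂ p e w-addable shortest
  augment-shortest IH {M₁} {M₂} iJ₁ _ (_ , p ∷ʳ inj₁ e , inj₂ w-addable) shortest =
    unionIndep-+ₛ-comm {M₁} {M₂} (reroute (IH ≤-refl) iJ₁ (swap-path p) e w-addable
                                (λ j<m path → shortest j<m (swap-sinkPath path)))

  augments : ∀ m → Augments m
  augments = <-rec Augments augment-shorter-or-shortest
    where
      augment-shorter-or-shortest : ∀ m → (∀ {j} → j < m → Augments j) → Augments m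
      augment-shorter-or-shortest m IH {M₁} {M₂} {J₁} {J₂} {y} iJ₁ iJ₂ path
        with em₁ {∃[ j ] (j < m × SinkPath M₁ M₂ J₁ J₂ y j)}
      ... | yes (j , j<m , shorter) = IH j<m iJ₁ iJ₂ shorter
      ... | no none = augment-shortest IH iJ₁ iJ₂ path (λ j<m path′ → none (_ , j<m , path′))

  module ExchangeIntoMaximal {M₁ M₂ : Matroid A} {I₁ I₂ : Subset A} {x : A}
                             (iI₁ : Independent M₁ I₁) (iI₂ : Independent M₂ I₂)
                             (x∈I₁ : x ∈ I₁) where

    J₁ J₂ : Subset A
    J₁ = I₁ -ₛ x
    J₂ = I₂ -ₛ x

    iJ₁ : Independent M₁ J₁
    iJ₁ = indep-⊆ M₁ iI₁ proj₁

    iJ₂ : Independent M₂ J₂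
    iJ₂ = indep-⊆ M₂ iI₂ proj₁

    Reachable : A → Set₁
    Reachable z = ∃[ m ] SinkPath M₁ M₂ J₁ J₂ z m

    -- Reachable is Set₁-valued; R is the same predicate as a subset of A, via excluded middle.
    R : Subset A
    R z = True (em₁ {Reachable z})

    sink∈R : ∀ {z} → Sink M₁ M₂ J₁ J₂ z → z ∈ R
    sink∈R {z} s = fromWitness (0 , z , [] , s)

    edge∈R : ∀ {z w} → Edge M₁ M₂ J₁ J₂ z w → w ∈ R → z ∈ R
    edge∈R e w∈R with toWitness w∈R
    ... | m , v , p , s = fromWitness (suc m , v , e ◅ p , s)

    open MatroidFacts using (cl; cl-mono; exchange-closed⇒∁⊆cl; spanned-∪-indep)

    ∁R⊆cl₁ : ∀ {z} → z ∉ R → z ∈ cl M₁ (I₁ ∖ R)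
    ∁R⊆cl₁ z∉R = cl-mono M₁ (λ (z∈J₁ , z∉R) → proj₁ z∈J₁ , z∉R)
                   (exchange-closed⇒∁⊆cl M₁ iJ₁ (λ a → sink∈R (inj₁ a)) (λ e → edge∈R (inj₁ e))
                                          z∉R)

    ∁R⊆cl₂ : ∀ {z} → z ∉ R → z ∈ cl M₂ (I₂ ∖ R)
    ∁R⊆cl₂ z∉R = cl-mono M₂ (λ (z∈J₂ , z∉R) → proj₁ z∈J₂ , z∉R)
                   (exchange-closed⇒∁⊆cl M₂ iJ₂ (λ a → sink∈R (inj₂ a)) (λ e → edge∈R (inj₂ e))
                                          z∉R)

    -- Otherwise the union-independent set C below would contain B and x.
    reachable-outside : ∀ {B} → Maximal (unionIndep M₁ M₂) B → x ∉ B →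
                        ∃[ b ] (b ∈ B × b ∈ R × b ∉ J₁ ∪ J₂)
    reachable-outside {B} ((B₁ , B₂ , iB₁ , iB₂ , B⊆B₁∪B₂ , _) , maximal) x∉B =
      dne₀ λ none → x∉B (maximal C (C₁ , C₂ , iC₁ , iC₂ , (λ c → c) , (λ c → c)) (B⊆C none)
                                 (inj₁ (inj₂ (x∈I₁ , x∈R))))
      where
        x∈R : x ∈ R
        x∈R = sink∈R (inj₁ ((λ x∈J₁ → proj₂ x∈J₁ refl) ,
                            indep-⊆ M₁ iI₁ [ proj₁ , (λ { refl → x∈I₁ }) ]))

        C₁ C₂ C : Subset A
        C₁ = (B₁ ∖ R) ∪ (I₁ ∩ R)
        C₂ = (B₂ ∖ R) ∪ (I₂ ∩ R)
        C = C₁ ∪ C₂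

        iC₁ : Independent M₁ C₁
        iC₁ = spanned-∪-indep M₁ (indep-⊆ M₁ iB₁ proj₁) iI₁ (λ (_ , z∉R) → ∁R⊆cl₁ z∉R)

        iC₂ : Independent M₂ C₂
        iC₂ = spanned-∪-indep M₂ (indep-⊆ M₂ iB₂ proj₁) iI₂ (λ (_ , z∉R) → ∁R⊆cl₂ z∉R)

        B⊆C : ¬ (∃[ b ] (b ∈ B × b ∈ R × b ∉ J₁ ∪ J₂)) → B ⊆ C
        B⊆C none {b} b∈B with B⊆B₁∪B₂ b∈B | em₀ {b ∈ R}
        ... | inj₁ b∈B₁ | no b∉R = inj₁ (inj₁ (b∈B₁ , b∉R))
        ... | inj₂ b∈B₂ | no b∉R = inj₂ (inj₁ (b∈B₂ , b∉R))
        ... | _ | yes b∈R with dne₀ (λ b∉J → none (b , b∈B , b∈R , b∉J))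
        ...   | inj₁ b∈J₁ = inj₁ (inj₂ (proj₁ b∈J₁ , b∈R))
        ...   | inj₂ b∈J₂ = inj₂ (inj₂ (proj₁ b∈J₂ , b∈R))

    exchange : ∀ {B} → Maximal (unionIndep M₁ M₂) B → x ∉ B →
               ∃[ y ] (y ∈ B × y ∉ I₁ ∪ I₂ × ((I₁ ∪ I₂) +ₛ y) -ₛ x ∈ unionIndep M₁ M₂)
    exchange maxB x∉B with reachable-outside maxB x∉B
    ... | b , b∈B , b∈R , b∉J with toWitness b∈R
    ...   | m , path =
      b , b∈B , b∉I , unionIndep-⊆ {M₁} {M₂} (augments m iJ₁ iJ₂ path) remove-x
      where
        b≢x : b ≢ x
        b≢x refl = x∉B b∈B

        b∉I : b ∉ I₁ ∪ I₂
        b∉I (inj₁ b∈I₁) = b∉J (inj₁ (b∈I₁ , b≢x))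
        b∉I (inj₂ b∈I₂) = b∉J (inj₂ (b∈I₂ , b≢x))

        remove-x : ((I₁ ∪ I₂) +ₛ b) -ₛ x ⊆ (J₁ ∪ J₂) +ₛ b
        remove-x (inj₁ (inj₁ z∈I₁) , z≢x) = inj₁ (inj₁ (z∈I₁ , z≢x))
        remove-x (inj₁ (inj₂ z∈I₂) , z≢x) = inj₁ (inj₂ (z∈I₂ , z≢x))
        remove-x (inj₂ z≡b , _) = inj₂ z≡b

  exchange-into-maximal : ∀ {M₁ M₂ : Matroid A} {I₁ I₂ B x} →
                          Independent M₁ I₁ → Independent M₂ I₂ → Maximal (unionIndep M₁ M₂) B →
                          x ∈ I₁ ∪ I₂ → x ∉ B →
                          ∃[ y ] (y ∈ B × y ∉ I₁ ∪ I₂ × ((I₁ ∪ I₂) +ₛ y) -ₛ x ∈ unionIndep M₁ M₂)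
  exchange-into-maximal {M₁} {M₂} {I₁} {I₂} {B} {x} iI₁ iI₂ maxB (inj₁ x∈I₁) x∉B =
    ExchangeIntoMaximal.exchange {M₁} {M₂} {I₁} {I₂} {x} iI₁ iI₂ x∈I₁ {B} maxB x∉B
  exchange-into-maximal {M₁} {M₂} {I₁} {I₂} {B} {x} iI₁ iI₂ maxB (inj₂ x∈I₂) x∉B =
    swap-back (ExchangeIntoMaximal.exchange {M₂} {M₁} {I₂} {I₁} {x} iI₂ iI₁ x∈I₂ {B}
                 (unionMaximal-comm {M₁} {M₂} maxB) x∉B)
    where
      swap-back : ∃[ y ] (y ∈ B × y ∉ I₂ ∪ I₁ × ((I₂ ∪ I₁) +ₛ y) -ₛ x ∈ unionIndep M₂ M₁) →
                  ∃[ y ] (y ∈ B × y ∉ I₁ ∪ I₂ × ((I₁ ∪ I₂) +ₛ y) -ₛ x ∈ unionIndep M₁ M₂)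
      swap-back (y , y∈B , y∉I , indep) =
        y , y∈B , (λ y∈I → y∉I (Data.Sum.swap y∈I)) ,
        unionIndep-⊆ {M₁} {M₂} (unionIndep-comm {M₂} {M₁} indep)
                     (-ₛ-mono {K = (I₁ ∪ I₂) +ₛ y} (+ₛ-mono {K = I₁ ∪ I₂} Data.Sum.swap))

proposition4p4 : ExcludedMiddle 0ℓ → ExcludedMiddle (Level.suc 0ℓ) →
    {A : Set} (M₁ M₂ : Matroid A) (I B : Subset A) →
    I ∈ unionIndep M₁ M₂ → Maximal (unionIndep M₁ M₂) B →
    (x : A) → x ∈ I → x ∉ B →
    ∃[ y ] (y ∈ B × y ∉ I × ((I +ₛ y) -ₛ x) ∈ unionIndep M₁ M₂)
proposition4p4 em₀ em₁ {A} M₁ M₂ I B (I₁ , I₂ , iI₁ , iI₂ , I⊆I₁∪I₂ , _) maxB x x∈I x∉B =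
  restrict (exchange-into-maximal {M₁} {M₂} {I₁} {I₂} {B} {x} iI₁ iI₂ maxB (I⊆I₁∪I₂ x∈I) x∉B)
  where
    open WithExcludedMiddle em₀ em₁ {A}

    restrict : ∃[ y ] (y ∈ B × y ∉ I₁ ∪ I₂ × ((I₁ ∪ I₂) +ₛ y) -ₛ x ∈ unionIndep M₁ M₂) →
               ∃[ y ] (y ∈ B × y ∉ I × ((I +ₛ y) -ₛ x) ∈ unionIndep M₁ M₂)
    restrict (y , y∈B , y∉I₁∪I₂ , indep) =
      y , y∈B , (λ y∈I → y∉I₁∪I₂ (I⊆I₁∪I₂ y∈I)) ,
      unionIndep-⊆ {M₁} {M₂} indep (-ₛ-mono {K = I +ₛ y} (+ₛ-mono {K = I} I⊆I₁∪I₂))
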